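{- Let $I$ be a small category and $(\mathcal{L}(i))_{i\in I}$ a family of complete Heyting algebras. For any object $(D,\delta)$ of $\mathbf{FuzzyPresheaf}(I,\mathcal{L})$ there is an equivalence of categories $$\mathbf{FuzzyPresheaf}(I,\mathcal{L})/(D,\delta)\ \simeq\ \mathbf{FuzzyPresheaf}\big(\textstyle\int D,\tilde{\mathcal{L}}\big),$$ where $\tilde{\mathcal{L}}(i,d)=\mathcal{L}(i)_{\leq \delta_i(d)}=\{x\in\mathcal{L}(i): x\leq\delta_i(d)\}$ for each object $(i,d)$ of $\int D$.
   Context: Given a category $J$ and a family of posets $(\mathcal{L}(j))_{j\in J}$ indexed by the objects of $J$, an $\mathcal{L}$-fuzzy presheaf on $J$ is a pair $(A,\alpha)$ where $A: J^{op}\to \mathbf{Set}$ is a functor and $\alpha=(\alpha_j : A(j)\to \mathcal{L}(j))_{j}$ is a family of functions; a morphism $f:(A,\alpha)\to(B,\beta)$ is a natural transformation $f:A\to B$ with $\alpha_j \leq \beta_j f_j$ pointwise; these form $\mathbf{FuzzyPresheaf}(J,\mathcal{L})$. The slice category over $(D,\delta)$ has objects morphisms $p:(A,\alpha)\to(D,\delta)$ and morphisms $f$ with $p=qf$. For a presheaf $D: I^{op}\to\mathbf{Set}$, its category of elements $\int D$ has objects pairs $(i,d)$ with $i\in I$, $d\in D(i)$, and morphisms $\iota:(j,e)\to(i,d)$ the $I$-morphisms $\iota:j\to i$ with $D(\iota)(d)=e$. -}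

module Defs where

open import Level using (Level; _⊔_; 0ℓ) renaming (suc to lsuc)
open import Data.Product using (Σ; Σ-syntax; _,_; proj₁; proj₂)
open import Relation.Binary using (Rel; IsEquivalence; Poset)
open import Relation.Binary.Lattice.Bundles using (HeytingAlgebra)
import Relation.Binary.Construct.On as On
open import Relation.Binary.PropositionalEquality as ≡ using (_≡_; refl)
import Relation.Binary.Reasoning.Setoid as SetoidR

record Category (o ℓ e : Level) : Set (lsuc (o ⊔ ℓ ⊔ e)) where
  infixr 9 _∘_
  infix  4 _≈_
  field
    Obj       : Set o
    _⇒_       : Obj → Obj → Set ℓ
    _≈_       : ∀ {A B} → Rel (A ⇒ B) e
    id        : ∀ {A} → A ⇒ A
    _∘_       : ∀ {A B C} → B ⇒ C → A ⇒ B → A ⇒ C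
    equiv     : ∀ {A B} → IsEquivalence (_≈_ {A} {B})
    assoc     : ∀ {A B C D} {f : A ⇒ B} {g : B ⇒ C} {h : C ⇒ D} →
                (h ∘ g) ∘ f ≈ h ∘ (g ∘ f)
    identityˡ : ∀ {A B} {f : A ⇒ B} → id ∘ f ≈ f
    identityʳ : ∀ {A B} {f : A ⇒ B} → f ∘ id ≈ f
    ∘-resp-≈  : ∀ {A B C} {f h : B ⇒ C} {g i : A ⇒ B} →
                f ≈ h → g ≈ i → f ∘ g ≈ h ∘ i

  module Eq {A B} = IsEquivalence (equiv {A} {B})

record Functor {o ℓ e o′ ℓ′ e′} (C : Category o ℓ e) (D : Category o′ ℓ′ e′)
       : Set (o ⊔ ℓ ⊔ e ⊔ o′ ⊔ ℓ′ ⊔ e′) where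
  private
    module C = Category C
    module D = Category D
  field
    F₀           : C.Obj → D.Obj
    F₁           : ∀ {A B} → A C.⇒ B → F₀ A D.⇒ F₀ B
    identity     : ∀ {A} → F₁ (C.id {A}) D.≈ D.id
    homomorphism : ∀ {X Y Z} {f : X C.⇒ Y} {g : Y C.⇒ Z} →
                   F₁ (g C.∘ f) D.≈ F₁ g D.∘ F₁ f
    F-resp-≈     : ∀ {A B} {f g : A C.⇒ B} → f C.≈ g → F₁ f D.≈ F₁ g

idF : ∀ {o ℓ e} {C : Category o ℓ e} → Functor C C
idF {C = C} = record
  { F₀ = λ A → A ; F₁ = λ f → f
  ; identity = C.Eq.refl ; homomorphism = C.Eq.refl ; F-resp-≈ = λ p → p }
  where module C = Category C

_∘F_ : ∀ {o ℓ e o′ ℓ′ e′ o″ ℓ″ e″}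
         {C : Category o ℓ e} {D : Category o′ ℓ′ e′} {E : Category o″ ℓ″ e″} →
       Functor D E → Functor C D → Functor C E
_∘F_ {E = E} G F = record
  { F₀ = λ A → G.F₀ (F.F₀ A)
  ; F₁ = λ f → G.F₁ (F.F₁ f)
  ; identity = E.Eq.trans (G.F-resp-≈ F.identity) G.identity
  ; homomorphism = E.Eq.trans (G.F-resp-≈ F.homomorphism) G.homomorphism
  ; F-resp-≈ = λ p → G.F-resp-≈ (F.F-resp-≈ p) }
  where
    module E = Category E
    module F = Functor F
    module G = Functor G

record NaturalIsomorphism {o ℓ e o′ ℓ′ e′} {C : Category o ℓ e} {D : Category o′ ℓ′ e′}
       (F G : Functor C D) : Set (o ⊔ ℓ ⊔ e ⊔ o′ ⊔ ℓ′ ⊔ e′) where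
  private
    module C = Category C
    module D = Category D
    module F = Functor F
    module G = Functor G
  field
    η        : ∀ X → F.F₀ X D.⇒ G.F₀ X
    η⁻¹      : ∀ X → G.F₀ X D.⇒ F.F₀ X
    isoˡ     : ∀ X → η⁻¹ X D.∘ η X D.≈ D.id
    isoʳ     : ∀ X → η X D.∘ η⁻¹ X D.≈ D.id
    commute  : ∀ {X Y} (f : X C.⇒ Y) → η Y D.∘ F.F₁ f D.≈ G.F₁ f D.∘ η X

record Equivalence {o ℓ e o′ ℓ′ e′} (C : Category o ℓ e) (D : Category o′ ℓ′ e′)
       : Set (o ⊔ ℓ ⊔ e ⊔ o′ ⊔ ℓ′ ⊔ e′) where
  field
    F      : Functor C D
    G      : Functor D C
    unit   : NaturalIsomorphism (idF {C = C}) (G ∘F F)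
    counit : NaturalIsomorphism (F ∘F G) (idF {C = D})

Slice : ∀ {o ℓ e} (C : Category o ℓ e) → Category.Obj C → Category (o ⊔ ℓ) (ℓ ⊔ e) e
Slice C X = record
  { Obj = Σ[ A ∈ Obj ] (A ⇒ X)
  ; _⇒_ = λ { (A , p) (B , q) → Σ[ f ∈ A ⇒ B ] (p ≈ q ∘ f) }
  ; _≈_ = λ f g → proj₁ f ≈ proj₁ g
  ; id = λ { {A , p} → id , Eq.sym identityʳ }
  ; _∘_ = λ { {A , p} {B , q} {D , r} (g , q≈rg) (f , p≈qf) →
              (g ∘ f) , Eq.trans p≈qf (Eq.trans (∘-resp-≈ q≈rg Eq.refl) assoc) }
  ; equiv = record { refl = Eq.refl ; sym = Eq.sym ; trans = Eq.trans }
  ; assoc = assoc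
  ; identityˡ = identityˡ
  ; identityʳ = identityʳ
  ; ∘-resp-≈ = ∘-resp-≈
  }
  where open Category C

record Presheaf (I : Category 0ℓ 0ℓ 0ℓ) : Set₁ where
  open Category I
  field
    F₀       : Obj → Set
    F₁       : ∀ {i j} → j ⇒ i → F₀ i → F₀ j
    identity : ∀ {i} (x : F₀ i) → F₁ (id {i}) x ≡ x
    homomorphism : ∀ {i j k} (f : j ⇒ k) (g : i ⇒ j) (x : F₀ k) →
                   F₁ (f ∘ g) x ≡ F₁ g (F₁ f x)
    F-resp-≈ : ∀ {i j} {f g : j ⇒ i} → f ≈ g → ∀ x → F₁ f x ≡ F₁ g x

record NatTrans {I : Category 0ℓ 0ℓ 0ℓ} (A B : Presheaf I) : Set where
  open Category I
  private
    module A = Presheaf A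
    module B = Presheaf B
  field
    η       : ∀ i → A.F₀ i → B.F₀ i
    natural : ∀ {i j} (f : j ⇒ i) (x : A.F₀ i) → η j (A.F₁ f x) ≡ B.F₁ f (η i x)

record FuzzyObj (J : Category 0ℓ 0ℓ 0ℓ) (L : Category.Obj J → Poset 0ℓ 0ℓ 0ℓ) : Set₁ where
  field
    A : Presheaf J
    α : ∀ j → Presheaf.F₀ A j → Poset.Carrier (L j)

record FuzzyHom {J : Category 0ℓ 0ℓ 0ℓ} {L : Category.Obj J → Poset 0ℓ 0ℓ 0ℓ}
                (X Y : FuzzyObj J L) : Set where
  private
    module X = FuzzyObj X
    module Y = FuzzyObj Y
  field
    f   : NatTrans X.A Y.A
    ≤-f : ∀ j (x : Presheaf.F₀ X.A j) →
          Poset._≤_ (L j) (X.α j x) (Y.α j (NatTrans.η f j x))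

FuzzyPresheaf : (J : Category 0ℓ 0ℓ 0ℓ) (L : Category.Obj J → Poset 0ℓ 0ℓ 0ℓ) →
                Category (Level.suc 0ℓ) 0ℓ 0ℓ
FuzzyPresheaf J L = record
  { Obj = FuzzyObj J L
  ; _⇒_ = FuzzyHom
  ; _≈_ = λ f g → ∀ j x → NatTrans.η (FuzzyHom.f f) j x ≡ NatTrans.η (FuzzyHom.f g) j x
  ; id = record
      { f = record { η = λ j x → x ; natural = λ f x → refl }
      ; ≤-f = λ j x → Poset.refl (L j) }
  ; _∘_ = λ g f → record
      { f = record
          { η = λ j x → ηf g j (ηf f j x)
          ; natural = λ {i} {j} h x →
              ≡.trans (≡.cong (ηf g j) (NatTrans.natural (FuzzyHom.f f) h x))
                      (NatTrans.natural (FuzzyHom.f g) h (ηf f i x)) }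
      ; ≤-f = λ j x → Poset.trans (L j) (FuzzyHom.≤-f f j x) (FuzzyHom.≤-f g j (ηf f j x)) }
  ; equiv = record
      { refl = λ j x → refl
      ; sym = λ p j x → ≡.sym (p j x)
      ; trans = λ p q j x → ≡.trans (p j x) (q j x) }
  ; assoc = λ j x → refl
  ; identityˡ = λ j x → refl
  ; identityʳ = λ j x → refl
  ; ∘-resp-≈ = λ {_} {_} {_} {f} {h} {g} {i} p q j x →
      ≡.trans (≡.cong (NatTrans.η (FuzzyHom.f f) j) (q j x)) (p j _)
  }
  where
    ηf : ∀ {X Y : FuzzyObj J L} → FuzzyHom X Y → ∀ j → _
    ηf h = NatTrans.η (FuzzyHom.f h)

∫ : (I : Category 0ℓ 0ℓ 0ℓ) → Presheaf I → Category 0ℓ 0ℓ 0ℓ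
∫ I D = record
  { Obj = Σ[ i ∈ Obj ] D.F₀ i
  ; _⇒_ = λ { (j , e) (i , d) → Σ[ ι ∈ j ⇒ i ] (D.F₁ ι d ≡ e) }
  ; _≈_ = λ ι κ → proj₁ ι ≈ proj₁ κ
  ; id = λ { {i , d} → id , D.identity d }
  ; _∘_ = λ { {k , c} {j , e} {i , d} (ι , p) (κ , q) →
              (ι ∘ κ) , ≡.trans (D.homomorphism ι κ d) (≡.trans (≡.cong (D.F₁ κ) p) q) }
  ; equiv = record { refl = Eq.refl ; sym = Eq.sym ; trans = Eq.trans }
  ; assoc = assoc
  ; identityˡ = identityˡ
  ; identityʳ = identityʳ
  ; ∘-resp-≈ = ∘-resp-≈
  }
  where
    open Category I
    module D = Presheaf D

record CompleteHeytingAlgebra : Set₁ where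
  field
    heytingAlgebra : HeytingAlgebra 0ℓ 0ℓ 0ℓ
  open HeytingAlgebra heytingAlgebra public
  field
    ⋁       : {K : Set} → (K → Carrier) → Carrier
    ⋁-upper : {K : Set} (f : K → Carrier) (k : K) → f k ≤ ⋁ f
    ⋁-least : {K : Set} (f : K → Carrier) (z : Carrier) →
              (∀ k → f k ≤ z) → ⋁ f ≤ z

-- the down-set P_{≤ a} = { x ∈ P : x ≤ a } with the induced order
↓ : (P : Poset 0ℓ 0ℓ 0ℓ) → Poset.Carrier P → Poset 0ℓ 0ℓ 0ℓ
↓ P a = On.poset P (proj₁ {B = λ x → Poset._≤_ P x a})

L̃ : (I : Category 0ℓ 0ℓ 0ℓ) (L : Category.Obj I → Poset 0ℓ 0ℓ 0ℓ)
    (Dδ : FuzzyObj I L) → Category.Obj (∫ I (FuzzyObj.A Dδ)) → Poset 0ℓ 0ℓ 0ℓ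
L̃ I L Dδ (i , d) = ↓ (L i) (FuzzyObj.α Dδ i d)

-- A fuzzy presheaf p : (A, α) → (D, δ) over (D, δ) splits into its fibres
-- A(i, d) = p_i⁻¹(d), a presheaf on ∫ D; since α_i(a) ≤ δ_i(p_i a) = δ_i(d),
-- the membership degrees of the fibre over (i, d) lie in L(i)_{≤ δ_i(d)}.
-- Conversely a fuzzy presheaf (B, β) on ∫ D is reassembled into the total
-- presheaf i ↦ Σ_d B(i, d), projecting to D, with the degree of (d, b) bounded
-- by δ_i(d).  Both round trips are the identity up to reshuffling Σ-types
-- (with equality of fibre elements decided by the first component, by UIP).
module Submission where

open import Defs
open import Level using (0ℓ) renaming (suc to lsuc)
open import Relation.Binary using (Poset)
open import Relation.Binary.Lattice.Bundles using (HeytingAlgebra)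
open import Data.Product using (Σ-syntax; _,_; proj₁; proj₂)
open import Relation.Binary.PropositionalEquality using (_≡_; refl; trans; sym; cong; subst)
open import Axiom.UniquenessOfIdentityProofs.WithK using (uip)

Fibre : {X Y : Set} → (X → Y) → Y → Set
Fibre {X} h d = Σ[ a ∈ X ] (h a ≡ d)

fibre-≡ : {X Y : Set} (h : X → Y) {d : Y} {a a′ : X} {r : h a ≡ d} {r′ : h a′ ≡ d} →
          a ≡ a′ → _≡_ {A = Fibre h d} (a , r) (a′ , r′)
fibre-≡ h {r = r} {r′} refl = cong (_ ,_) (uip r r′)

total-fibre-≡ : {X Y : Set} (h : X → Y) {d d′ : Y} {a a′ : X} {r : h a ≡ d} {r′ : h a′ ≡ d′} →
                d ≡ d′ → a ≡ a′ → _≡_ {A = Σ[ y ∈ Y ] Fibre h y} (d , a , r) (d′ , a′ , r′)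
total-fibre-≡ h {r = r} {r′} refl refl = cong (λ s → _ , _ , s) (uip r r′)

module _ {J : Category 0ℓ 0ℓ 0ℓ} {L : Category.Obj J → Poset 0ℓ 0ℓ 0ℓ} {X Y : FuzzyObj J L} where

  private
    module X = Presheaf (FuzzyObj.A X)
    module Y = Presheaf (FuzzyObj.A Y)

  η : FuzzyHom X Y → ∀ j → X.F₀ j → Y.F₀ j
  η h = NatTrans.η (FuzzyHom.f h)

  natural : (h : FuzzyHom X Y) {i j : Category.Obj J} (ι : Category._⇒_ J j i) →
            ∀ x → η h j (X.F₁ ι x) ≡ Y.F₁ ι (η h i x)
  natural h = NatTrans.natural (FuzzyHom.f h)

module SliceOverElements (I : Category 0ℓ 0ℓ 0ℓ) (L : Category.Obj I → Poset 0ℓ 0ℓ 0ℓ)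
                         (Dδ : FuzzyObj I L) where

  open Category I using (_⇒_; _∘_) renaming (id to idI)

  private
    D = FuzzyObj.A Dδ
    δ = FuzzyObj.α Dδ
    module D = Presheaf D
    module L i = Poset (L i)

  Over : Category (lsuc 0ℓ) 0ℓ 0ℓ
  Over = Slice (FuzzyPresheaf I L) Dδ

  OnElements : Category (lsuc 0ℓ) 0ℓ 0ℓ
  OnElements = FuzzyPresheaf (∫ I D) (L̃ I L Dδ)

  module Over = Category Over
  module OnElements = Category OnElements

  fibres : (X : FuzzyObj I L) → FuzzyHom X Dδ → OnElements.Obj
  fibres X p = record { A = fibresPresheaf ; α = degree }
    where
      module A = Presheaf (FuzzyObj.A X)
      α = FuzzyObj.α X

      fibresPresheaf : Presheaf (∫ I D)
      fibresPresheaf = record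
        { F₀ = λ { (i , d) → Fibre (η p i) d }
        ; F₁ = λ { (ι , q) (a , r) →
                   A.F₁ ι a , trans (natural p ι a) (trans (cong (D.F₁ ι) r) q) }
        ; identity = λ { {i , _} (a , _) → fibre-≡ (η p i) (A.identity a) }
        ; homomorphism = λ { {k , _} (ι , _) (κ , _) (a , _) →
                             fibre-≡ (η p k) (A.homomorphism ι κ a) }
        ; F-resp-≈ = λ { {_} {j , _} ι≈κ (a , _) → fibre-≡ (η p j) (A.F-resp-≈ ι≈κ a) }
        }

      degree : ∀ x → Presheaf.F₀ fibresPresheaf x → Poset.Carrier (L̃ I L Dδ x)
      degree (i , d) (a , r) =
        α i a , subst (λ d → L._≤_ i (α i a) (δ i d)) r (FuzzyHom.≤-f p i a)

  total : OnElements.Obj → Over.Obj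
  total Y = record { A = totalPresheaf ; α = λ { i (d , b) → proj₁ (β (i , d) b) } }
          , projection
    where
      module B = Presheaf (FuzzyObj.A Y)
      β = FuzzyObj.α Y

      restrict : ∀ {i j} (ι : j ⇒ i) {d : D.F₀ i} → B.F₀ (i , d) → B.F₀ (j , D.F₁ ι d)
      restrict ι = B.F₁ (ι , refl)

      restrict-≡ : ∀ {i j d e} (ι : j ⇒ i) (q : D.F₁ ι d ≡ e) (b : B.F₀ (i , d)) →
                   _≡_ {A = Σ[ x ∈ D.F₀ j ] B.F₀ (j , x)}
                       (D.F₁ ι d , restrict ι b) (e , B.F₁ (ι , q) b)
      restrict-≡ ι refl b = refl

      totalPresheaf : Presheaf I
      totalPresheaf = record
        { F₀ = λ i → Σ[ d ∈ D.F₀ i ] B.F₀ (i , d)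
        ; F₁ = λ { ι (d , b) → D.F₁ ι d , restrict ι b }
        ; identity = λ { (d , b) →
            trans (restrict-≡ idI (D.identity d) b) (cong (d ,_) (B.identity b)) }
        ; homomorphism = λ { ι κ (d , b) →
            trans (restrict-≡ (ι ∘ κ) _ b)
                  (cong (_ ,_) (B.homomorphism (ι , refl) (κ , refl) b)) }
        ; F-resp-≈ = λ { {f = ι} {κ} ι≈κ (d , b) →
            trans (restrict-≡ ι (D.F-resp-≈ ι≈κ d) b)
                  (cong (_ ,_) (B.F-resp-≈ {f = ι , _} {g = κ , refl} ι≈κ b)) }
        }

      projection : FuzzyHom (record { A = totalPresheaf ; α = _ }) Dδ
      projection = record
        { f = record { η = λ { i (d , b) → d } ; natural = λ { ι (d , b) → refl } }
        ; ≤-f = λ { i (d , b) → proj₂ (β (i , d) b) } }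

  Fibres : Functor Over OnElements
  Fibres = record
    { F₀ = λ { (X , p) → fibres X p }
    ; F₁ = λ { {_} {Y , q} (g , p≈qg) → record
        { f = record
          { η = λ { (i , d) (a , r) → η g i a , trans (sym (p≈qg i a)) r }
          ; natural = λ { {_} {j , _} (ι , _) (a , _) → fibre-≡ (η q j) (natural g ι a) } }
        ; ≤-f = λ { (i , d) (a , r) → FuzzyHom.≤-f g i a } } }
    ; identity = λ _ _ → refl
    ; homomorphism = λ { {Z = _ , s} (i , _) _ → fibre-≡ (η s i) refl }
    ; F-resp-≈ = λ { {B = _ , q} g≈h (i , _) (a , _) → fibre-≡ (η q i) (g≈h i a) }
    }

  Total : Functor OnElements Over
  Total = record
    { F₀ = total
    ; F₁ = λ h → record
        { f = record
          { η = λ { i (d , b) → d , η h (i , d) b }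
          ; natural = λ { ι (d , b) → cong (_ ,_) (natural h (ι , refl) b) } }
        ; ≤-f = λ { i (d , b) → FuzzyHom.≤-f h (i , d) b } }
      , λ _ _ → refl
    ; identity = λ _ _ → refl
    ; homomorphism = λ _ _ → refl
    ; F-resp-≈ = λ { g≈h i (d , b) → cong (d ,_) (g≈h (i , d) b) }
    }

  unit : NaturalIsomorphism (idF {C = Over}) (Total ∘F Fibres)
  unit = record
    { η = λ { (X , p) → record
        { f = record
          { η = λ i a → η p i a , a , refl
          ; natural = λ { {j = j} ι a → total-fibre-≡ (η p j) (natural p ι a) refl } }
        ; ≤-f = λ i a → L.refl i } , λ _ _ → refl }
    ; η⁻¹ = λ { (X , p) → record
        { f = record
          { η = λ { i (d , a , r) → a }
          ; natural = λ { ι (d , a , r) → refl } }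
        ; ≤-f = λ { i _ → L.refl i } } , λ { j (d , a , r) → sym r } }
    ; isoˡ = λ _ _ _ → refl
    ; isoʳ = λ { (X , p) i (d , a , r) → total-fibre-≡ (η p i) r refl }
    ; commute = λ { {Y = Y , q} (g , p≈qg) i a → total-fibre-≡ (η q i) (sym (p≈qg i a)) refl }
    }

  counit : NaturalIsomorphism (Fibres ∘F Total) (idF {C = OnElements})
  counit = record
    { η = λ Y → record
        { f = record
          { η = λ { (i , d) ((_ , b) , r) → subst (λ x → Presheaf.F₀ (FuzzyObj.A Y) (i , x)) r b }
          ; natural = λ { (ι , refl) (_ , refl) → refl } }
        ; ≤-f = λ { (i , d) (_ , refl) → L.refl i } }
    ; η⁻¹ = λ Y → record
        { f = record
          { η = λ { (i , d) b → (d , b) , refl }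
          ; natural = λ { (ι , refl) b → refl } }
        ; ≤-f = λ { (i , d) b → L.refl i } }
    ; isoˡ = λ { Y (i , d) (_ , refl) → refl }
    ; isoʳ = λ _ _ _ → refl
    ; commute = λ { h (i , d) (_ , refl) → refl }
    }

  equivalence : Equivalence Over OnElements
  equivalence = record { F = Fibres ; G = Total ; unit = unit ; counit = counit }

lemma34 : (I : Category 0ℓ 0ℓ 0ℓ) (L : Category.Obj I → CompleteHeytingAlgebra)
          (Dδ : FuzzyObj I (λ i → HeytingAlgebra.poset (CompleteHeytingAlgebra.heytingAlgebra (L i)))) →
          Equivalence
            (Slice (FuzzyPresheaf I (λ i → HeytingAlgebra.poset (CompleteHeytingAlgebra.heytingAlgebra (L i)))) Dδ)
            (FuzzyPresheaf (∫ I (FuzzyObj.A Dδ))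
               (L̃ I (λ i → HeytingAlgebra.poset (CompleteHeytingAlgebra.heytingAlgebra (L i))) Dδ))
lemma34 I L =
  SliceOverElements.equivalence I (λ i → HeytingAlgebra.poset (CompleteHeytingAlgebra.heytingAlgebra (L i)))
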